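{- Let $a\mapsto M_a$ be any function from $\Lambda_{P_0,H}$ to $\mathbb{Z}$. Then for every $M\in\mathbb{Z}$ there exist, for each standard Rankin–Selberg parabolic subgroup $Q$ of $G$, an integer $i_Q\ge0$ and elements $a_{i,Q}\in\Lambda_{P_0,H}[\ge M]$ ($1\le i\le i_Q$), together with integers $M'_{a_{i,Q}}\ge M_{a_{i,Q}}$, such that $\Lambda_{P_0,H}[\ge M]=\bigsqcup_Q\bigsqcup_{i=1}^{i_Q}\left(a_{i,Q}+\Lambda_{Q,H}[\ge M'_{a_{i,Q}}]\right)$ (disjoint union).
   Context: $G=\mathrm{GL}_n\times\mathrm{GL}_{n+1}$. A standard Rankin–Selberg parabolic subgroup is $Q=(Q_{n+1}\cap\mathrm{GL}_n)\times Q_{n+1}$ for a standard (upper triangular) parabolic $Q_{n+1}$ of $\mathrm{GL}_{n+1}$, where $\mathrm{GL}_n\subset\mathrm{GL}_{n+1}$ via $g\mapsto\mathrm{diag}(g,1)$; these are in bijection with ordered compositions $(n_1,\dots,n_m)$ of $n+1$ (the block sizes of $Q_{n+1}$). $\Lambda_{P_0,H}=\mathbb{Z}^n$ (cocharacters $t\mapsto(\mathrm{diag}(t^{a_1},..,t^{a_n}),\mathrm{diag}(t^{a_1},..,t^{a_n},1))$). For $Q$ with blocks $(n_1,\dots,n_m)$ of $\{1,\dots,n+1\}$, $\Lambda_{Q,H}\subset\mathbb{Z}^n$ is the subgroup of $a$ such that, setting $a_{n+1}:=0$, $a$ is constant on each block, with value $x_k$ on block $k$ (so $x_m=0$); $\Delta_{Q,H}=\{\alpha_k:a\mapsto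 x_k-x_{k+1}\mid 1\le k\le m-1\}$ and $\Lambda_{Q,H}[\ge M]=\{a\in\Lambda_{Q,H}\mid\alpha(a)\ge M\ \forall\alpha\in\Delta_{Q,H}\}$. $P_0$ corresponds to the composition $(1,\dots,1)$, so $\Lambda_{P_0,H}[\ge M]=\{a\in\mathbb{Z}^n\mid a_k-a_{k+1}\ge M,\ 1\le k\le n\}$ with $a_{n+1}=0$. For $Q=G$ (composition $(n+1)$), $\Lambda_{G,H}=\{0\}$. -}

module Defs where

open import Data.Nat using (ℕ; suc; _<_)
open import Data.Integer using (ℤ; _-_; _≤_) renaming (_+_ to _+ℤ_)
open import Data.List using (List; []; _∷_; _++_; concat; zipWith; replicate; length; [_])
open import Data.Nat.ListAction using (sum)
open import Data.List.Relation.Unary.All using (All)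
open import Data.List.Relation.Unary.Linked using (Linked)
open import Data.Vec using (Vec; toList)
import Data.Vec as Vec
open import Data.Product using (Σ; _×_)
open import Relation.Binary.PropositionalEquality using (_≡_)

-- Λ_{P0,H} = ℤ^n, represented as Vec ℤ n.
Lam : ℕ → Set
Lam n = Vec ℤ n

-- An ordered composition (n_1,…,n_m) of n+1 (block sizes of Q_{n+1}),
-- i.e. a standard Rankin–Selberg parabolic subgroup Q of GL_n × GL_{n+1}.
IsComposition : ℕ → List ℕ → Set
IsComposition n Q = All (0 <_) Q × sum Q ≡ suc n

expand : List ℕ → List ℤ → List ℤ
expand Q xs = concat (zipWith replicate Q xs)

-- a ∈ Λ_{Q,H}[≥ M] : setting a_{n+1} := 0, a is constant on each block with
-- value x_k on block k (so x_m = 0), and x_k - x_{k+1} ≥ M for 1 ≤ k ≤ m-1.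
InLamQ≥ : (n : ℕ) → List ℕ → ℤ → Lam n → Set
InLamQ≥ n Q M a =
  Σ (List ℤ) λ xs →
    (length xs ≡ length Q)
    × (expand Q xs ≡ toList a ++ [ Data.Integer.+ 0 ])
    × Linked (λ u v → M ≤ u - v) xs

P0 : ℕ → List ℕ
P0 n = replicate (suc n) 1

InLamP0≥ : (n : ℕ) → ℤ → Lam n → Set
InLamP0≥ n M a = InLamQ≥ n (P0 n) M a

_−ᵛ_ : ∀ {n} → Lam n → Lam n → Lam n
x −ᵛ a = Vec.zipWith _-_ x a

InTranslate : (n : ℕ) → List ℕ → Lam n × ℤ → Lam n → Set
InTranslate n Q (a Data.Product., M') x = InLamQ≥ n Q M' (x −ᵛ a)

{-# OPTIONS --safe #-}
-- In the difference coordinates d_k = a_k - a_{k+1} (with a_{n+1} = 0), Λ_{P0,H}[≥ M] is the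
-- orthant {d | d_k ≥ M} and a + Λ_{Q,H}[≥ M'] is the set of d that agree with the
-- differences of a inside the blocks of Q and exceed them by at least M' across block
-- boundaries.  Call slice a set of d each of whose coordinates is either fixed to a level
-- M + c or free and at least M + L.  Such a slice splits into the same slice with the larger
-- bound M + T, T = L + |M_a|, which is the translate by its corner a with admissible M' = T,
-- and the slices fixing some free coordinates to levels in [M + L, M + T).  The latter have
-- fewer free coordinates, so recursing from the orthant terminates.  Covering and
-- disjointness follow from one count: a point lies in as many of the parts as in the slice
-- that was split, hence in exactly one piece of the orthant.

module Submission where

open import Defs
open import Data.Bool using (Bool; true; false; if_then_else_)
open import Data.Empty using (⊥-elim)
open import Data.Fin using (Fin; toℕ; zero; suc)
import Data.Fin.Properties as Fin
open import Data.Integer as ℤ using (ℤ; _≤_; +_; -[1+_]; -≤+; -_; 0ℤ; _-_; ∣_∣; _≤?_; _≟_)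
  renaming (_+_ to _+ℤ_; suc to sucℤ)
import Data.Integer.Properties as ℤ
open import Data.Integer.Tactic.RingSolver using (solve-∀)
open import Data.List using (List; length; lookup; []; _∷_; _++_; map; concatMap; [_])
open import Data.List.Properties using (map-++; map-cong; map-cong-local; ∷-injectiveˡ; ∷-injectiveʳ; ≡-dec)
open import Data.List.Relation.Unary.All using (All; []; _∷_; universal)
import Data.List.Relation.Unary.All as All
open import Data.List.Relation.Unary.All.Properties using (map⁺; ++⁺; concat⁺)
open import Data.List.Relation.Unary.Linked using ([-]; _∷_)
open import Data.Maybe using (Maybe; just; nothing; is-nothing)
open import Data.Nat as ℕ using (ℕ; zero; suc; _+_; _*_; _<_; z≤n; s≤s)
import Data.Nat.Properties as ℕ
open import Data.Nat.ListAction using (sum)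
open import Data.Nat.ListAction.Properties using (sum-++)
import Data.Nat.Tactic.RingSolver as ℕ-Solver
open import Data.Product using (Σ; _×_; _,_; proj₁; proj₂)
open import Data.Vec using (Vec; []; _∷_; toList)
import Data.Vec as Vec
open import Data.Vec.Relation.Binary.Pointwise.Inductive as Pointwise using (Pointwise; []; _∷_)
open import Data.Vec.Relation.Unary.All using ([]; _∷_)
import Data.Vec.Relation.Unary.All as VAll
import Data.Vec.Relation.Unary.All.Properties as VAll
open import Function using (_∘_; _⇔_; mk⇔; Equivalence)
open Equivalence using (to; from)
import Function.Properties.Equivalence as ⇔
open import Relation.Binary using (DecidableEquality; tri<; tri≈; tri>)
open import Relation.Binary.PropositionalEquality
  using (_≡_; refl; sym; trans; cong; cong₂; subst; subst₂; module ≡-Reasoning)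
open import Relation.Nullary using (Dec; does; yes; no; ¬_; contradiction)
open import Relation.Nullary.Decidable using (_×-dec_)
open import Relation.Unary using (Decidable)

𝟙 : {P : Set} → Dec P → ℕ
𝟙 P? = if does P? then 1 else 0

module _ {P : Set} where

  𝟙-yes : (P? : Dec P) → P → 𝟙 P? ≡ 1
  𝟙-yes (yes _) _ = refl
  𝟙-yes (no ¬p) p = contradiction p ¬p

  𝟙-no : (P? : Dec P) → ¬ P → 𝟙 P? ≡ 0
  𝟙-no (yes p) ¬p = contradiction p ¬p
  𝟙-no (no _)  _  = refl

  𝟙≤1 : (P? : Dec P) → 𝟙 P? ℕ.≤ 1
  𝟙≤1 (yes _) = ℕ.≤-refl
  𝟙≤1 (no _)  = z≤n

  𝟙-×-dec : {Q : Set} (P? : Dec P) (Q? : Dec Q) → 𝟙 (P? ×-dec Q?) ≡ 𝟙 P? * 𝟙 Q?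
  𝟙-×-dec (yes _) (yes _) = refl
  𝟙-×-dec (yes _) (no _)  = refl
  𝟙-×-dec (no _)  _       = refl

sum-map-++ : {A : Set} (f : A → ℕ) (xs ys : List A) →
             sum (map f (xs ++ ys)) ≡ sum (map f xs) + sum (map f ys)
sum-map-++ f xs ys = trans (cong sum (map-++ f xs ys)) (sum-++ (map f xs) (map f ys))

sum-map-*ʳ : {A : Set} (c : ℕ) (f : A → ℕ) (xs : List A) →
             sum (map (λ x → f x * c) xs) ≡ sum (map f xs) * c
sum-map-*ʳ c f []       = refl
sum-map-*ʳ c f (x ∷ xs) =
  trans (cong (_+_ (f x * c)) (sum-map-*ʳ c f xs)) (sym (ℕ.*-distribʳ-+ c (f x) _))

sum-map-concatMap : {A B : Set} (f : B → ℕ) (g : A → List B) (xs : List A) →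
                    sum (map f (concatMap g xs)) ≡ sum (map (λ x → sum (map f (g x))) xs)
sum-map-concatMap f g []       = refl
sum-map-concatMap f g (x ∷ xs) =
  trans (sum-map-++ f (g x) (concatMap g xs)) (cong (_+_ (sum (map f (g x)))) (sum-map-concatMap f g xs))

module _ {A : Set} {P : A → Set} (P? : Decidable P) where

  count : List A → ℕ
  count xs = sum (map (𝟙 ∘ P?) xs)

  count-∷ : ∀ {x} xs → P x → count (x ∷ xs) ≡ suc (count xs)
  count-∷ {x} xs px = cong (λ i → i + count xs) (𝟙-yes (P? x) px)

  count-lookup : ∀ xs p → P (lookup xs p) → 1 ℕ.≤ count xs
  count-lookup (x ∷ xs) zero    px = subst (1 ℕ.≤_) (sym (count-∷ xs px)) (s≤s z≤n)
  count-lookup (x ∷ xs) (suc p) h  = ℕ.≤-trans (count-lookup xs p h) (ℕ.m≤n+m _ _)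

  count-witness : ∀ xs → 1 ℕ.≤ count xs → Σ (Fin (length xs)) λ p → P (lookup xs p)
  count-witness (x ∷ xs) h with P? x
  ... | yes px = zero , px
  ... | no _   = let p , pp = count-witness xs h in suc p , pp

  count≤1⇒¬P-tail : ∀ {x} xs q → count (x ∷ xs) ℕ.≤ 1 → P x → ¬ P (lookup xs q)
  count≤1⇒¬P-tail xs q c px pq =
    ℕ.<-irrefl refl (ℕ.≤-trans (s≤s (count-lookup xs q pq)) (subst (ℕ._≤ 1) (count-∷ xs px) c))

  count≤1-unique : ∀ xs p q → count xs ℕ.≤ 1 → P (lookup xs p) → P (lookup xs q) → p ≡ q
  count≤1-unique (x ∷ xs) zero    zero    _ _  _  = refl
  count≤1-unique (x ∷ xs) zero    (suc q) c px pq = ⊥-elim (count≤1⇒¬P-tail xs q c px pq)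
  count≤1-unique (x ∷ xs) (suc p) zero    c pp px = ⊥-elim (count≤1⇒¬P-tail xs p c px pp)
  count≤1-unique (x ∷ xs) (suc p) (suc q) c pp pq =
    cong suc (count≤1-unique xs p q (ℕ.≤-trans (ℕ.m≤n+m _ _) c) pp pq)

module Keyed {A B K : Set} (_≟ₖ_ : DecidableEquality K) (key : A → K) (f : A → B) where

  keyed : K → List A → List B
  keyed k [] = []
  keyed k (x ∷ xs) with key x ≟ₖ k
  ... | yes _ = f x ∷ keyed k xs
  ... | no _  = keyed k xs

  position : ∀ k xs → Fin (length (keyed k xs)) → Fin (length xs)
  position k (x ∷ xs) i with key x ≟ₖ k
  position k (x ∷ xs) zero    | yes _ = zero
  position k (x ∷ xs) (suc i) | yes _ = suc (position k xs i)
  position k (x ∷ xs) i       | no _  = suc (position k xs i)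

  lookup-keyed : ∀ k xs i → lookup (keyed k xs) i ≡ f (lookup xs (position k xs i))
  lookup-keyed k (x ∷ xs) i with key x ≟ₖ k
  lookup-keyed k (x ∷ xs) zero    | yes _ = refl
  lookup-keyed k (x ∷ xs) (suc i) | yes _ = lookup-keyed k xs i
  lookup-keyed k (x ∷ xs) i       | no _  = lookup-keyed k xs i

  key-position : ∀ k xs i → key (lookup xs (position k xs i)) ≡ k
  key-position k (x ∷ xs) i with key x ≟ₖ k
  key-position k (x ∷ xs) zero    | yes e = e
  key-position k (x ∷ xs) (suc i) | yes _ = key-position k xs i
  key-position k (x ∷ xs) i       | no _  = key-position k xs i

  position-injective : ∀ k xs i j → position k xs i ≡ position k xs j → i ≡ j
  position-injective k (x ∷ xs) i j e with key x ≟ₖ k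
  position-injective k (x ∷ xs) zero    zero    e | yes _ = refl
  position-injective k (x ∷ xs) (suc i) (suc j) e | yes _ =
    cong suc (position-injective k xs i j (Fin.suc-injective e))
  position-injective k (x ∷ xs) i       j       e | no _  =
    position-injective k xs i j (Fin.suc-injective e)

  position-surjective : ∀ xs p →
    Σ (Fin (length (keyed (key (lookup xs p)) xs))) λ i → position (key (lookup xs p)) xs i ≡ p
  position-surjective (x ∷ xs) zero with key x ≟ₖ key x
  ... | yes _ = zero , refl
  ... | no ¬e = contradiction refl ¬e
  position-surjective (x ∷ xs) (suc p) with key x ≟ₖ key (lookup xs p) | position-surjective xs p
  ... | yes _ | i , e = suc i , cong suc e
  ... | no _  | i , e = i , cong suc e

  keyed⁺ : ∀ {P : B → Set} k xs → All (P ∘ f) xs → All P (keyed k xs)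
  keyed⁺ k []       []         = []
  keyed⁺ k (x ∷ xs) (px ∷ pxs) with key x ≟ₖ k
  ... | yes _ = px ∷ keyed⁺ k xs pxs
  ... | no _  = keyed⁺ k xs pxs

private
  [i+j]-j≡i : ∀ i j → (i +ℤ j) - j ≡ i
  [i+j]-j≡i = solve-∀

  [i+j]-i≡j : ∀ i j → (i +ℤ j) - i ≡ j
  [i+j]-i≡j = solve-∀

  i+[j-i]≡j : ∀ i j → i +ℤ (j - i) ≡ j
  i+[j-i]≡j = solve-∀

  i+[1+j]≡1+[i+j] : ∀ i j → i +ℤ (+ 1 +ℤ j) ≡ + 1 +ℤ (i +ℤ j)
  i+[1+j]≡1+[i+j] = solve-∀

  [i-j]-[k-l]≡[i-k]-[j-l] : ∀ i j k l → (i - j) - (k - l) ≡ (i - k) - (j - l)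
  [i-j]-[k-l]≡[i-k]-[j-l] = solve-∀

  [s+t]*[a+c]≡t*a+[t*c+s*[a+c]] : ∀ s t a c → (s + t) * (a + c) ≡ t * a + (t * c + s * (a + c))
  [s+t]*[a+c]≡t*a+[t*c+s*[a+c]] = ℕ-Solver.solve-∀

i≤+∣i∣ : ∀ i → i ≤ + ∣ i ∣
i≤+∣i∣ (+ _)    = ℤ.≤-refl
i≤+∣i∣ -[1+ _ ] = -≤+

𝟙-≤-split : ∀ a e → 𝟙 (a ≤? e) ≡ 𝟙 (e ≟ a) + 𝟙 (sucℤ a ≤? e)
𝟙-≤-split a e with ℤ.<-cmp a e
... | tri< a<e a≢e _ =
  trans (𝟙-yes (a ≤? e) (ℤ.<⇒≤ a<e))
        (sym (cong₂ _+_ (𝟙-no (e ≟ a) (a≢e ∘ sym))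
                        (𝟙-yes (sucℤ a ≤? e) (ℤ.i<j⇒suc[i]≤j a<e))))
... | tri≈ _ refl _ =
  trans (𝟙-yes (a ≤? a) ℤ.≤-refl)
        (sym (cong₂ _+_ (𝟙-yes (a ≟ a) refl)
                        (𝟙-no (sucℤ a ≤? a) (ℤ.<-irrefl refl ∘ ℤ.suc[i]≤j⇒i<j))))
... | tri> _ _ e<a =
  trans (𝟙-no (a ≤? e) (ℤ.<⇒≱ e<a))
        (sym (cong₂ _+_ (𝟙-no (e ≟ a) (ℤ.<⇒≢ e<a))
                        (𝟙-no (sucℤ a ≤? e) (ℤ.<⇒≱ e<a ∘ ℤ.<⇒≤ ∘ ℤ.suc[i]≤j⇒i<j))))

head₀ : ∀ {k} → Vec ℤ k → ℤ
head₀ []      = 0ℤ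
head₀ (a ∷ _) = a

diffs : ∀ {k} → Vec ℤ k → Vec ℤ k
diffs []       = []
diffs (a ∷ as) = a - head₀ as ∷ diffs as

sums : ∀ {k} → Vec ℤ k → Vec ℤ k
sums []       = []
sums (e ∷ es) = e +ℤ head₀ (sums es) ∷ sums es

diffs-sums : ∀ {k} (e : Vec ℤ k) → diffs (sums e) ≡ e
diffs-sums []       = refl
diffs-sums (e ∷ es) = cong₂ _∷_ ([i+j]-j≡i e (head₀ (sums es))) (diffs-sums es)

head₀-−ᵛ : ∀ {k} (x a : Vec ℤ k) → head₀ (x −ᵛ a) ≡ head₀ x - head₀ a
head₀-−ᵛ []      []      = refl
head₀-−ᵛ (_ ∷ _) (_ ∷ _) = refl

diffs-−ᵛ : ∀ {k} (x a : Vec ℤ k) → diffs (x −ᵛ a) ≡ diffs x −ᵛ diffs a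
diffs-−ᵛ []       []       = refl
diffs-−ᵛ (x ∷ xs) (a ∷ as) = cong₂ _∷_
  (trans (cong (_-_ (x - a)) (head₀-−ᵛ xs as)) ([i-j]-[k-l]≡[i-k]-[j-l] x a (head₀ xs) (head₀ as)))
  (diffs-−ᵛ xs as)

-- A shape s marks with true the positions k such that k and k + 1 lie in different blocks.
firstRun : ∀ {k} → Vec Bool k → ℕ
firstRun []          = 0
firstRun (true  ∷ _) = 0
firstRun (false ∷ s) = suc (firstRun s)

laterBlocks : ∀ {k} → Vec Bool k → List ℕ
laterBlocks []          = []
laterBlocks (true  ∷ s) = suc (firstRun s) ∷ laterBlocks s
laterBlocks (false ∷ s) = laterBlocks s

blocks : ∀ {k} → Vec Bool k → List ℕ
blocks s = suc (firstRun s) ∷ laterBlocks s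

blocks-isComposition : ∀ {k} (s : Vec Bool k) → IsComposition k (blocks s)
blocks-isComposition s = s≤s z≤n ∷ laterBlocks-positive s , sum-blocks s
  where
  laterBlocks-positive : ∀ {k} (s : Vec Bool k) → All (0 <_) (laterBlocks s)
  laterBlocks-positive []          = []
  laterBlocks-positive (true  ∷ s) = s≤s z≤n ∷ laterBlocks-positive s
  laterBlocks-positive (false ∷ s) = laterBlocks-positive s

  sum-blocks : ∀ {k} (s : Vec Bool k) → sum (blocks s) ≡ suc k
  sum-blocks []          = refl
  sum-blocks (true  ∷ s) = cong suc (sum-blocks s)
  sum-blocks (false ∷ s) = cong suc (sum-blocks s)

blocks-replicate-true : ∀ k → blocks (Vec.replicate k true) ≡ P0 k
blocks-replicate-true zero    = refl
blocks-replicate-true (suc k) = cong (1 ∷_) (blocks-replicate-true k)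

ConeCoord : ℤ → Bool → ℤ → Set
ConeCoord M' true  e = M' ≤ e
ConeCoord M' false e = e ≡ 0ℤ

head₀-toList : ∀ {k} (y : Vec ℤ k) {x rest} → x ∷ rest ≡ toList y ++ [ 0ℤ ] → x ≡ head₀ y
head₀-toList []      e = ∷-injectiveˡ e
head₀-toList (_ ∷ _) e = ∷-injectiveˡ e

InLamQ≥-blocks⇒ : ∀ {k} (s : Vec Bool k) M' (y : Vec ℤ k) →
                  InLamQ≥ k (blocks s) M' y → Pointwise (ConeCoord M') s (diffs y)
InLamQ≥-blocks⇒ []          M' []       _ = []
InLamQ≥-blocks⇒ (true ∷ s)  M' (y ∷ ys) (x ∷ x₂ ∷ xs , len , ex , x-x₂ ∷ lk) =
  subst₂ (λ a b → M' ≤ a - b) (∷-injectiveˡ ex) (head₀-toList ys (∷-injectiveʳ ex)) x-x₂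
  ∷ InLamQ≥-blocks⇒ s M' ys (x₂ ∷ xs , ℕ.suc-injective len , ∷-injectiveʳ ex , lk)
InLamQ≥-blocks⇒ (false ∷ s) M' (y ∷ ys) (x ∷ xs , len , ex , lk) =
  ℤ.i≡j⇒i-j≡0 (trans (sym (∷-injectiveˡ ex)) (head₀-toList ys (∷-injectiveʳ ex)))
  ∷ InLamQ≥-blocks⇒ s M' ys (x ∷ xs , len , ∷-injectiveʳ ex , lk)

InLamQ≥-blocks⇐ : ∀ {k} (s : Vec Bool k) M' (y : Vec ℤ k) →
                  Pointwise (ConeCoord M') s (diffs y) → InLamQ≥ k (blocks s) M' y
InLamQ≥-blocks⇐ []          M' []       []                 = 0ℤ ∷ [] , refl , refl , [-]
InLamQ≥-blocks⇐ (true ∷ s)  M' (y ∷ ys) (y-y₂ ∷ hs) with InLamQ≥-blocks⇐ s M' ys hs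
... | x₂ ∷ xs , len , ex , lk =
  y ∷ x₂ ∷ xs , cong suc len , cong (y ∷_) ex ,
  subst (λ b → M' ≤ y - b) (sym (head₀-toList ys ex)) y-y₂ ∷ lk
InLamQ≥-blocks⇐ (false ∷ s) M' (y ∷ ys) (y-y₂≡0 ∷ hs) with InLamQ≥-blocks⇐ s M' ys hs
... | x ∷ xs , len , ex , lk =
  x ∷ xs , len , cong₂ _∷_ (trans (head₀-toList ys ex) (sym (ℤ.i-j≡0⇒i≡j y _ y-y₂≡0))) ex , lk

InLamQ≥-blocks⇔ : ∀ {k} (s : Vec Bool k) M' (y : Vec ℤ k) →
                  InLamQ≥ k (blocks s) M' y ⇔ Pointwise (ConeCoord M') s (diffs y)
InLamQ≥-blocks⇔ s M' y = mk⇔ (InLamQ≥-blocks⇒ s M' y) (InLamQ≥-blocks⇐ s M' y)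

cone-replicate-true⇔All : ∀ {k} M' (d : Vec ℤ k) →
                          Pointwise (ConeCoord M') (Vec.replicate k true) d ⇔ VAll.All (M' ≤_) d
cone-replicate-true⇔All M' d = mk⇔ (⇒All d) (All⇒ d)
  where
  ⇒All : ∀ {k} (d : Vec ℤ k) → Pointwise (ConeCoord M') (Vec.replicate k true) d → VAll.All (M' ≤_) d
  ⇒All []      []       = []
  ⇒All (_ ∷ d) (h ∷ hs) = h ∷ ⇒All d hs

  All⇒ : ∀ {k} (d : Vec ℤ k) → VAll.All (M' ≤_) d → Pointwise (ConeCoord M') (Vec.replicate k true) d
  All⇒ []      []       = []
  All⇒ (_ ∷ d) (h ∷ hs) = h ∷ All⇒ d hs

InLamP0≥⇔ : ∀ {n} M (x : Lam n) → InLamP0≥ n M x ⇔ VAll.All (M ≤_) (diffs x)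
InLamP0≥⇔ {n} M x = ⇔.trans
  (subst (λ Q → InLamQ≥ n Q M x ⇔ Pointwise (ConeCoord M) (Vec.replicate n true) (diffs x))
         (blocks-replicate-true n) (InLamQ≥-blocks⇔ (Vec.replicate n true) M x))
  (cone-replicate-true⇔All M (diffs x))

Slice : ℕ → Set
Slice = Vec (Maybe ℕ)

free : ∀ k → Slice k
free k = Vec.replicate k nothing

dim : ∀ {k} → Slice k → ℕ
dim []            = 0
dim (nothing ∷ r) = suc (dim r)
dim (just _  ∷ r) = dim r

dim-free : ∀ k → dim (free k) ≡ k
dim-free zero    = refl
dim-free (suc k) = cong suc (dim-free k)

interval : ℕ → ℕ → List ℕ
interval L zero    = []
interval L (suc K) = L ∷ interval (suc L) K

-- All slices other than r obtained by fixing some free coordinates of r to levels in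
-- interval L K.
refinements : ∀ {k} → ℕ → ℕ → Slice k → List (Slice k)
refinements L K []            = []
refinements L K (just c  ∷ r) = map (just c ∷_) (refinements L K r)
refinements L K (nothing ∷ r) =
  map (nothing ∷_) (refinements L K r)
  ++ concatMap (λ c → map (just c ∷_) (r ∷ refinements L K r)) (interval L K)

refinements-dim : ∀ {k} L K (r : Slice k) → All (λ q → dim q < dim r) (refinements L K r)
refinements-dim L K []            = []
refinements-dim L K (just c  ∷ r) = map⁺ (refinements-dim L K r)
refinements-dim L K (nothing ∷ r) =
  ++⁺ (map⁺ (All.map s≤s (refinements-dim L K r)))
      (concat⁺ (map⁺ (universal
        (λ c → map⁺ (ℕ.n<1+n (dim r) ∷ All.map ℕ.m<n⇒m<1+n (refinements-dim L K r))) (interval L K))))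

Piece : ℕ → Set
Piece n = Slice n × ℕ

module _ {n} (B : Slice n → ℕ) where

  pieces : ℕ → Slice n → ℕ → List (Piece n)
  pieces zero    r L = []
  pieces (suc f) r L = (r , L + B r) ∷ concatMap (λ q → pieces f q (L + B r)) (refinements L (B r) r)

  pieces-bounded : ∀ f r L → All (λ p → B (proj₁ p) ℕ.≤ proj₂ p) (pieces f r L)
  pieces-bounded zero    r L = []
  pieces-bounded (suc f) r L =
    ℕ.m≤n+m (B r) L
    ∷ concat⁺ (map⁺ (universal (λ q → pieces-bounded f q (L + B r)) (refinements L (B r) r)))

module Slicing (M : ℤ) where

  -- Fixed coordinates and lower bounds are offsets above M, so every piece lies in the orthant.
  Admits : ℕ → Maybe ℕ → ℤ → Set
  Admits T nothing  e = M +ℤ + T ≤ e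
  Admits T (just c) e = e ≡ M +ℤ + c

  admits? : ∀ T m e → Dec (Admits T m e)
  admits? T nothing  e = M +ℤ + T ≤? e
  admits? T (just c) e = e ≟ M +ℤ + c

  _∈[_≥_] : ∀ {k} → Vec ℤ k → Slice k → ℕ → Set
  d ∈[ r ≥ T ] = Pointwise (Admits T) r d

  _∈?[_≥_] : ∀ {k} (d : Vec ℤ k) r T → Dec (d ∈[ r ≥ T ])
  d ∈?[ r ≥ T ] = Pointwise.decidable (admits? T) r d

  _∈ₚ_ : ∀ {n} → Vec ℤ n → Piece n → Set
  d ∈ₚ p = d ∈[ proj₁ p ≥ proj₂ p ]

  _∈ₚ?_ : ∀ {n} (d : Vec ℤ n) (p : Piece n) → Dec (d ∈ₚ p)
  d ∈ₚ? p = d ∈?[ proj₁ p ≥ proj₂ p ]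

  𝟙-∷ : ∀ {k} T m e (r : Slice k) d →
        𝟙 ((e ∷ d) ∈?[ m ∷ r ≥ T ]) ≡ 𝟙 (admits? T m e) * 𝟙 (d ∈?[ r ≥ T ])
  𝟙-∷ T m e r d = 𝟙-×-dec (admits? T m e) (d ∈?[ r ≥ T ])

  count-map-∷ : ∀ {k} T m e (d : Vec ℤ k) qs →
    count ((e ∷ d) ∈?[_≥ T ]) (map (m ∷_) qs) ≡ 𝟙 (admits? T m e) * count (d ∈?[_≥ T ]) qs
  count-map-∷ T m e d []       = sym (ℕ.*-zeroʳ (𝟙 (admits? T m e)))
  count-map-∷ T m e d (q ∷ qs) =
    trans (cong₂ _+_ (𝟙-∷ T m e q d) (count-map-∷ T m e d qs))
          (sym (ℕ.*-distribˡ-+ (𝟙 (admits? T m e)) _ _))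

  𝟙-≥-interval : ∀ L K e →
    𝟙 (M +ℤ + L ≤? e)
    ≡ sum (map (λ c → 𝟙 (e ≟ M +ℤ + c)) (interval L K)) + 𝟙 (M +ℤ + (L + K) ≤? e)
  𝟙-≥-interval L zero    e = cong (λ T → 𝟙 (M +ℤ + T ≤? e)) (sym (ℕ.+-identityʳ L))
  𝟙-≥-interval L (suc K) e = begin
    𝟙 (M +ℤ + L ≤? e)
      ≡⟨ 𝟙-≤-split (M +ℤ + L) e ⟩
    𝟙 (e ≟ M +ℤ + L) + 𝟙 (sucℤ (M +ℤ + L) ≤? e)
      ≡⟨ cong (λ a → 𝟙 (e ≟ M +ℤ + L) + 𝟙 (a ≤? e)) (i+[1+j]≡1+[i+j] M (+ L)) ⟨
    𝟙 (e ≟ M +ℤ + L) + 𝟙 (M +ℤ + suc L ≤? e)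
      ≡⟨ cong (_+_ (𝟙 (e ≟ M +ℤ + L))) (𝟙-≥-interval (suc L) K e) ⟩
    𝟙 (e ≟ M +ℤ + L) + (S + 𝟙 (M +ℤ + (suc L + K) ≤? e))
      ≡⟨ ℕ.+-assoc (𝟙 (e ≟ M +ℤ + L)) S _ ⟨
    𝟙 (e ≟ M +ℤ + L) + S + 𝟙 (M +ℤ + (suc L + K) ≤? e)
      ≡⟨ cong (λ T → 𝟙 (e ≟ M +ℤ + L) + S + 𝟙 (M +ℤ + T ≤? e)) (ℕ.+-suc L K) ⟨
    𝟙 (e ≟ M +ℤ + L) + S + 𝟙 (M +ℤ + (L + suc K) ≤? e) ∎
    where
    open ≡-Reasoning
    S = sum (map (λ c → 𝟙 (e ≟ M +ℤ + c)) (interval (suc L) K))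

  refinements-count : ∀ {k} L K (r : Slice k) d →
    𝟙 (d ∈?[ r ≥ L ]) ≡ 𝟙 (d ∈?[ r ≥ L + K ]) + count (d ∈?[_≥ L + K ]) (refinements L K r)
  refinements-count L K []            []      = refl
  refinements-count L K (just c  ∷ r) (e ∷ d) = begin
    𝟙 ((e ∷ d) ∈?[ just c ∷ r ≥ L ])
      ≡⟨ 𝟙-∷ L (just c) e r d ⟩
    x * 𝟙 (d ∈?[ r ≥ L ])
      ≡⟨ cong (x *_) (refinements-count L K r d) ⟩
    x * (𝟙 (d ∈?[ r ≥ L + K ]) + count (d ∈?[_≥ L + K ]) R)
      ≡⟨ ℕ.*-distribˡ-+ x _ _ ⟩
    x * 𝟙 (d ∈?[ r ≥ L + K ]) + x * count (d ∈?[_≥ L + K ]) R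
      ≡⟨ cong₂ _+_ (𝟙-∷ (L + K) (just c) e r d) (count-map-∷ (L + K) (just c) e d R) ⟨
    𝟙 ((e ∷ d) ∈?[ just c ∷ r ≥ L + K ]) + count ((e ∷ d) ∈?[_≥ L + K ]) (map (just c ∷_) R) ∎
    where
    open ≡-Reasoning
    x = 𝟙 (e ≟ M +ℤ + c)
    R = refinements L K r
  refinements-count L K (nothing ∷ r) (e ∷ d) = begin
    𝟙 ((e ∷ d) ∈?[ nothing ∷ r ≥ L ])
      ≡⟨ 𝟙-∷ L nothing e r d ⟩
    𝟙 (M +ℤ + L ≤? e) * 𝟙 (d ∈?[ r ≥ L ])
      ≡⟨ cong₂ _*_ (𝟙-≥-interval L K e) (refinements-count L K r d) ⟩
    (S + t) * (A + C)
      ≡⟨ [s+t]*[a+c]≡t*a+[t*c+s*[a+c]] S t A C ⟩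
    t * A + (t * C + S * (A + C))
      ≡⟨ cong (λ s → t * A + (t * C + s)) (sum-map-*ʳ (A + C) (λ c → 𝟙 (e ≟ M +ℤ + c)) I) ⟨
    t * A + (t * C + sum (map (λ c → 𝟙 (e ≟ M +ℤ + c) * (A + C)) I))
      ≡⟨ cong (λ s → t * A + (t * C + sum s))
              (map-cong (λ c → count-map-∷ T (just c) e d (r ∷ R)) I) ⟨
    t * A + (t * C + sum (map (λ c → count P (fixAt c)) I))
      ≡⟨ cong₂ (λ u v → t * A + (u + v))
               (count-map-∷ T nothing e d R) (sum-map-concatMap (𝟙 ∘ P) fixAt I) ⟨
    t * A + (count P (map (nothing ∷_) R) + count P (concatMap fixAt I))
      ≡⟨ cong₂ _+_ (𝟙-∷ T nothing e r d)
                   (sum-map-++ (𝟙 ∘ P) (map (nothing ∷_) R) (concatMap fixAt I)) ⟨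
    𝟙 ((e ∷ d) ∈?[ nothing ∷ r ≥ T ]) + count P (refinements L K (nothing ∷ r)) ∎
    where
    open ≡-Reasoning
    T = L + K
    R = refinements L K r
    I = interval L K
    fixAt : ℕ → List (Slice _)
    fixAt c = map (just c ∷_) (r ∷ R)
    P = (e ∷ d) ∈?[_≥ T ]
    t = 𝟙 (M +ℤ + T ≤? e)
    S = sum (map (λ c → 𝟙 (e ≟ M +ℤ + c)) I)
    A = 𝟙 (d ∈?[ r ≥ T ])
    C = count (d ∈?[_≥ T ]) R

  count-pieces : ∀ {n} (B : Slice n → ℕ) f r L d →
                 dim r < f → count (d ∈ₚ?_) (pieces B f r L) ≡ 𝟙 (d ∈?[ r ≥ L ])
  count-pieces B (suc f) r L d (s≤s dim≤f) = begin
    𝟙 (d ∈?[ r ≥ T ]) + count (d ∈ₚ?_) (concatMap (λ q → pieces B f q T) R)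
      ≡⟨ cong (_+_ (𝟙 (d ∈?[ r ≥ T ])))
              (sum-map-concatMap (𝟙 ∘ (d ∈ₚ?_)) (λ q → pieces B f q T) R) ⟩
    𝟙 (d ∈?[ r ≥ T ]) + sum (map (λ q → count (d ∈ₚ?_) (pieces B f q T)) R)
      ≡⟨ cong (λ s → 𝟙 (d ∈?[ r ≥ T ]) + sum s) (map-cong-local (All.map
           (λ dimq<dimr → count-pieces B f _ T d (ℕ.<-≤-trans dimq<dimr dim≤f)) (refinements-dim L (B r) r))) ⟩
    𝟙 (d ∈?[ r ≥ T ]) + count (d ∈?[_≥ T ]) R
      ≡⟨ refinements-count L (B r) r d ⟨
    𝟙 (d ∈?[ r ≥ L ]) ∎
    where
    open ≡-Reasoning
    T = L + B r
    R = refinements L (B r) r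

  level : Maybe ℕ → ℤ
  level nothing  = M
  level (just c) = M +ℤ + c

  apex : ∀ {k} → Slice k → Vec ℤ k
  apex r = sums (Vec.map level r)

  shape : ∀ {k} → Slice k → Vec Bool k
  shape = Vec.map is-nothing

  type : ∀ {n} → Piece n → List ℕ
  type (r , _) = blocks (shape r)

  translate : ∀ {n} → Piece n → Lam n × ℤ
  translate (r , T) = apex r , + T

  M≤level : ∀ m → M ≤ level m
  M≤level nothing  = ℤ.≤-refl
  M≤level (just c) = ℤ.i≤i+j M (+ c)

  M≤admitted : ∀ T m e → Admits T m e → M ≤ e
  M≤admitted T nothing  e h    = ℤ.≤-trans (ℤ.i≤i+j M (+ T)) h
  M≤admitted T (just c) e refl = M≤level (just c)

  ∈slice⇒All-M≤ : ∀ {k} {T} (r : Slice k) d → d ∈[ r ≥ T ] → VAll.All (M ≤_) d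
  ∈slice⇒All-M≤ []      []      []       = []
  ∈slice⇒All-M≤ (m ∷ r) (e ∷ d) (h ∷ hs) = M≤admitted _ m e h ∷ ∈slice⇒All-M≤ r d hs

  All-M≤⇒∈free : ∀ {k} (d : Vec ℤ k) → VAll.All (M ≤_) d → d ∈[ free k ≥ 0 ]
  All-M≤⇒∈free []      []       = []
  All-M≤⇒∈free (e ∷ d) (h ∷ hs) = subst (_≤ e) (sym (ℤ.+-identityʳ M)) h ∷ All-M≤⇒∈free d hs

  coneCoord-level⇔ : ∀ T m e → ConeCoord (+ T) (is-nothing m) (e - level m) ⇔ Admits T m e
  coneCoord-level⇔ T nothing  e = mk⇔
    (λ h → subst (M +ℤ + T ≤_) (i+[j-i]≡j M e) (ℤ.+-monoʳ-≤ M h))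
    (λ h → subst (_≤ e - M) ([i+j]-i≡j M (+ T)) (ℤ.+-monoˡ-≤ (- M) h))
  coneCoord-level⇔ T (just c) e = mk⇔ (ℤ.i-j≡0⇒i≡j e _) ℤ.i≡j⇒i-j≡0

  cone⇔slice : ∀ {k} T (r : Slice k) d →
               Pointwise (ConeCoord (+ T)) (shape r) (d −ᵛ Vec.map level r) ⇔ d ∈[ r ≥ T ]
  cone⇔slice T r d = mk⇔ (⇒slice r d) (slice⇒ r d)
    where
    ⇒slice : ∀ {k} (r : Slice k) d →
             Pointwise (ConeCoord (+ T)) (shape r) (d −ᵛ Vec.map level r) → d ∈[ r ≥ T ]
    ⇒slice []      []      []       = []
    ⇒slice (m ∷ r) (e ∷ d) (h ∷ hs) = to (coneCoord-level⇔ T m e) h ∷ ⇒slice r d hs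

    slice⇒ : ∀ {k} (r : Slice k) d →
             d ∈[ r ≥ T ] → Pointwise (ConeCoord (+ T)) (shape r) (d −ᵛ Vec.map level r)
    slice⇒ []      []      []       = []
    slice⇒ (m ∷ r) (e ∷ d) (h ∷ hs) = from (coneCoord-level⇔ T m e) h ∷ slice⇒ r d hs

  translate⇔ : ∀ {n} (p : Piece n) x → InTranslate n (type p) (translate p) x ⇔ diffs x ∈ₚ p
  translate⇔ (r , T) x = ⇔.trans
    (InLamQ≥-blocks⇔ (shape r) (+ T) (x −ᵛ apex r))
    (subst (λ y → Pointwise (ConeCoord (+ T)) (shape r) y ⇔ diffs x ∈[ r ≥ T ]) (sym diffs-shifted)
           (cone⇔slice T r (diffs x)))
    where
    diffs-shifted : diffs (x −ᵛ apex r) ≡ diffs x −ᵛ Vec.map level r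
    diffs-shifted = trans (diffs-−ᵛ x (apex r)) (cong (diffs x −ᵛ_) (diffs-sums (Vec.map level r)))

module Decomposition {n} (Ma : Lam n → ℤ) (M : ℤ) where
  open Slicing M
  open Keyed (≡-dec ℕ._≟_) (type {n}) (translate {n})

  bound : Slice n → ℕ
  bound r = ∣ Ma (apex r) ∣

  allPieces : List (Piece n)
  allPieces = pieces bound (suc n) (free n) 0

  D : List ℕ → List (Lam n × ℤ)
  D Q = keyed Q allPieces

  count-allPieces : ∀ (d : Vec ℤ n) → count (d ∈ₚ?_) allPieces ≡ 𝟙 (d ∈?[ free n ≥ 0 ])
  count-allPieces d = count-pieces bound (suc n) (free n) 0 d (s≤s (ℕ.≤-reflexive (dim-free n)))

  D-member : ∀ Q i (x : Lam n) → InTranslate n Q (lookup (D Q) i) x →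
             diffs x ∈ₚ lookup allPieces (position Q allPieces i)
  D-member Q i x h = to (translate⇔ (lookup allPieces (position Q allPieces i)) x)
    (subst₂ (λ Q' t → InTranslate n Q' t x) (sym (key-position Q allPieces i)) (lookup-keyed Q allPieces i) h)

  D-admissible : ∀ Q → All (λ p → InLamP0≥ n M (proj₁ p) × Ma (proj₁ p) ≤ proj₂ p) (D Q)
  D-admissible Q = keyed⁺ Q allPieces (All.map admissible (pieces-bounded bound (suc n) (free n) 0))
    where
    admissible : ∀ {p} → bound (proj₁ p) ℕ.≤ proj₂ p →
                 InLamP0≥ n M (apex (proj₁ p)) × Ma (apex (proj₁ p)) ≤ + proj₂ p
    admissible {r , T} bound≤T =
      from (InLamP0≥⇔ M (apex r))
           (subst (VAll.All (M ≤_)) (sym (diffs-sums (Vec.map level r))) (VAll.map⁺ (VAll.universal M≤level r)))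
      , ℤ.≤-trans (i≤+∣i∣ (Ma (apex r))) (ℤ.+≤+ bound≤T)

  D⊆Λ : ∀ Q (i : Fin (length (D Q))) x → InTranslate n Q (lookup (D Q) i) x → InLamP0≥ n M x
  D⊆Λ Q i x h = from (InLamP0≥⇔ M x) (∈slice⇒All-M≤ _ (diffs x) (D-member Q i x h))

  Λ⊆⋃D : ∀ x → InLamP0≥ n M x →
         Σ (List ℕ) λ Q → IsComposition n Q × Σ (Fin (length (D Q))) λ i →
           InTranslate n Q (lookup (D Q) i) x
  Λ⊆⋃D x h =
    let d∈free = All-M≤⇒∈free (diffs x) (to (InLamP0≥⇔ M x) h)
        count≡1 = trans (count-allPieces (diffs x)) (𝟙-yes (diffs x ∈?[ free n ≥ 0 ]) d∈free)
        k , d∈p = count-witness (diffs x ∈ₚ?_) allPieces (ℕ.≤-reflexive (sym count≡1))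
        p = lookup allPieces k
        i , position≡k = position-surjective allPieces k
    in type p , blocks-isComposition (shape (proj₁ p)) , i ,
       subst (λ t → InTranslate n (type p) t x)
             (sym (trans (lookup-keyed (type p) allPieces i) (cong (translate ∘ lookup allPieces) position≡k)))
             (from (translate⇔ p x) d∈p)

  same-position : ∀ Q Q' i j →
                  position Q allPieces i ≡ position Q' allPieces j → (Q ≡ Q') × (toℕ i ≡ toℕ j)
  same-position Q Q' i j e
    with trans (sym (key-position Q allPieces i))
               (trans (cong (type ∘ lookup allPieces) e) (key-position Q' allPieces j))
  ... | refl = refl , cong toℕ (position-injective Q allPieces i j e)

  D-disjoint : ∀ Q Q' (i : Fin (length (D Q))) (j : Fin (length (D Q'))) x →
               InTranslate n Q (lookup (D Q) i) x → InTranslate n Q' (lookup (D Q') j) x →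
               (Q ≡ Q') × (toℕ i ≡ toℕ j)
  D-disjoint Q Q' i j x h h' = same-position Q Q' i j
    (count≤1-unique (diffs x ∈ₚ?_) allPieces (position Q allPieces i) (position Q' allPieces j)
                    count≤1 (D-member Q i x h) (D-member Q' j x h'))
    where
    count≤1 : count (diffs x ∈ₚ?_) allPieces ℕ.≤ 1
    count≤1 = subst (ℕ._≤ 1) (sym (count-allPieces (diffs x))) (𝟙≤1 (diffs x ∈?[ free n ≥ 0 ]))

lemma7p7 : (n : ℕ) (Ma : Lam n → ℤ) (M : ℤ) →
  Σ (List ℕ → List (Lam n × ℤ)) λ D →
    (∀ Q → IsComposition n Q →
      All (λ p → InLamP0≥ n M (proj₁ p) × Ma (proj₁ p) ≤ proj₂ p) (D Q))
    × (∀ Q → IsComposition n Q → ∀ (i : Fin (length (D Q))) (x : Lam n) →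
        InTranslate n Q (lookup (D Q) i) x → InLamP0≥ n M x)
    × (∀ (x : Lam n) → InLamP0≥ n M x →
        Σ (List ℕ) λ Q → IsComposition n Q × Σ (Fin (length (D Q))) λ i →
          InTranslate n Q (lookup (D Q) i) x)
    × (∀ Q Q' → IsComposition n Q → IsComposition n Q' →
        ∀ (i : Fin (length (D Q))) (j : Fin (length (D Q'))) (x : Lam n) →
        InTranslate n Q (lookup (D Q) i) x → InTranslate n Q' (lookup (D Q') j) x →
        (Q ≡ Q') × (toℕ i ≡ toℕ j))
lemma7p7 n Ma M =
  D , (λ Q _ → D-admissible Q) , (λ Q _ → D⊆Λ Q) , Λ⊆⋃D , (λ Q Q' _ _ → D-disjoint Q Q')
  where open Decomposition Ma M
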